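{- Let $k \geq 2$ and let $t, r_1, \dots, r_k$ be positive integers with $t \leq r_1 \leq \dots \leq r_k$. For positive integers $t \leq r \leq s$ define \[n_0(r,s,t) = \max\left\{r(s-t) {r+s-t \choose t}, \, (r-t){r \choose t} {r+s-t \choose t+1}\right\} + t+1,\] and let $n \geq n_0(r_{k-1},r_k,t)$. If $\mathcal{A}_1 \subseteq {[n] \choose r_1}, \dots, \mathcal{A}_k \subseteq {[n] \choose r_k}$ are cross-$t$-intersecting, then \[\prod_{i=1}^k |\mathcal{A}_i| \leq \prod_{i=1}^k {n-t \choose r_i - t},\] and equality holds if and only if for some $T \in {[n] \choose t}$, $\mathcal{A}_i = \{A \in {[n] \choose r_i} \colon T \subseteq A\}$ for each $i \in [k]$.
   Context: $[n] = \{1,\dots,n\}$ and ${X \choose r}$ denotes the family of all $r$-element subsets of $X$. Families $\mathcal{A}_1, \dots, \mathcal{A}_k$ are cross-$t$-intersecting if for all distinct $i,j \in [k]$, $|A \cap B| \geq t$ for every $A \in \mathcal{A}_i$ and every $B \in \mathcal{A}_j$. The families may be empty. -}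

module Defs where

open import Data.Nat using (ℕ; zero; suc; _+_; _*_; _∸_; _⊔_; _≤_)
open import Data.Nat.Combinatorics using (_C_)
open import Data.Fin using (Fin; fromℕ; inject₁) renaming (zero to fzero; suc to fsuc)
open import Data.Fin.Subset using (Subset; _∩_; ∣_∣; _⊆_)
open import Data.Bool using (Bool; true; false)
open import Data.Vec using (_∷_; [])
open import Data.List using (List; []; _∷_; map; filter; length; _++_)
open import Data.Product using (_×_)
open import Relation.Binary.PropositionalEquality using (_≡_)
open import Relation.Nullary using (¬_)
open import Data.Bool.Properties using (T?)
open import Data.Bool using (T)

allSubsets : (n : ℕ) → List (Subset n)
allSubsets zero = [] ∷ []
allSubsets (suc n) = map (true ∷_) (allSubsets n) ++ map (false ∷_) (allSubsets n)

Family : ℕ → Set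
Family n = Subset n → Bool

card : {n : ℕ} → Family n → ℕ
card {n} 𝓐 = length (filter (λ S → T? (𝓐 S)) (allSubsets n))

Uniform : {n : ℕ} → ℕ → Family n → Set
Uniform r 𝓐 = ∀ S → 𝓐 S ≡ true → ∣ S ∣ ≡ r

CrossIntersecting : {k n : ℕ} → ℕ → (Fin k → Family n) → Set
CrossIntersecting t 𝓐 =
  ∀ i j → ¬ (i ≡ j) → ∀ A B → 𝓐 i A ≡ true → 𝓐 j B ≡ true → t ≤ ∣ A ∩ B ∣

prod : (k : ℕ) → (Fin k → ℕ) → ℕ
prod zero f = 1
prod (suc k) f = f fzero * prod k (λ i → f (fsuc i))

n0 : ℕ → ℕ → ℕ → ℕ
n0 r s t = (r * (s ∸ t) * ((r + s ∸ t) C t)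
            ⊔ (r ∸ t) * (r C t) * ((r + s ∸ t) C (t + 1))) + t + 1

lastIx : (m : ℕ) → Fin (suc (suc m))
lastIx m = fromℕ (suc m)

penultIx : (m : ℕ) → Fin (suc (suc m))
penultIx m = inject₁ (fromℕ m)

module Submission where

-- Call a t-set T a kernel of a family if T lies in every member.  Two cross-t-intersecting
-- families 𝓐 ⊆ ([n] choose r), 𝓑 ⊆ ([n] choose s) without a common kernel are far from extremal.
-- If 𝓐 has a kernel T but some B ∈ 𝓑 does not contain T, every A ∈ 𝓐 meets T ∪ B in t + 1
-- points, so 𝓐 is covered by at most s stars of (t+1)-sets, each smaller than a t-star by the
-- factor (r − t)/(n − t); meanwhile 𝓑 is covered by the (r choose t) t-stars inside a fixed
-- A ∈ 𝓐.  If neither family has a kernel, the first argument applies to 𝓐 restricted to each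
-- t-subset of a fixed B ∈ 𝓑, and symmetrically.  For n ≥ n₀ either way gives
-- |𝓐||𝓑| < C(n−t, r−t) C(n−t, s−t).  So any two of the k families either both lie in stars or
-- have product strictly below the star bound, which forces the product bound; equality makes
-- every family a full star, and a full r-star with r < n determines its centre.

open import Defs
open import Data.Nat using (ℕ; zero; suc; _+_; _*_; _∸_; _⊔_; _≤_; _<_; z≤n; s≤s; _≤′_; ≤′-refl; ≤′-step;
                            _≟_; _≤?_; _<?_; >-nonZero; >-nonZero⁻¹)
open import Data.Nat.Properties
open import Data.Nat.Combinatorics using (_C_; nCk+nC[k+1]≡[n+1]C[k+1]; k>n⇒nCk≡0; nC1≡n; nCk≡nC[n∸k])
open import Data.Nat.Tactic.RingSolver using (solve-∀)
open import Algebra.Properties.CommutativeSemigroup +-commutativeSemigroup using ()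
  renaming (interchange to +-interchange)
open import Algebra.Properties.CommutativeSemigroup *-commutativeSemigroup using ()
  renaming (interchange to *-interchange)
open import Data.Bool using (true; false; _∧_; _∨_; if_then_else_)
import Data.Bool as Bool
open import Data.Bool.Properties using (T?; T-≡; ∧-zeroʳ; ¬-not; ⇔→≡)
open import Data.Vec using ([]; _∷_; here)
open import Data.List using (List; []; _∷_; map; filter; length; _++_)
open import Data.List.Properties using (length-++; filter-++)
open import Data.Fin using (Fin) renaming (_≤_ to _≤ᶠ_; zero to fzero; suc to fsuc)
import Data.Fin as Fin
open import Data.Fin.Properties using (¬∀⟶∃¬; ∀-cons; ≤fromℕ) renaming (suc-injective to fsuc-injective)
open import Data.Fin.Subset using (Subset; inside; outside; _⊆_; _⊈_; _∈_; _∉_; _∩_; _∪_; ∁; ⁅_⁆; ∣_∣; ⊤; ⊥)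
open import Data.Fin.Subset.Properties
  using (_⊆?_; _∈?_; anySubset?; ⊆-refl; ⊆-trans; ⊆-antisym; ⊆-min; ⊆⊤; s⊆s; out⊆; drop-∷-⊆;
         p∩q⊆p; p∩q⊆q; p⊆p∪q; ∩-comm; x∈p∩q⁺; x∈p∩q⁻; x∈p∪q⁺; x∈⁅x⁆; x≢y⇒x∉⁅y⁆; x∈p⇒x∉∁p; x∉p⇒x∈∁p;
         ∣p∣≤∣x∷p∣; p⊆q⇒∣p∣≤∣q∣; p⊂q⇒∣p∣<∣q∣; ∣⊤∣≡n; ∣⊥∣≡0; ∣∁p∣≡n∸∣p∣; ∣⁅x⁆∣≡1)
open import Data.Product using (∃-syntax; _×_; _,_; proj₁; proj₂)
open import Data.Sum using (_⊎_; inj₁; inj₂; [_,_]′)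
import Data.Sum as Sum
open import Data.Empty using (⊥-elim)
open import Function using (_∘_)
open import Function.Bundles using (_⇔_; mk⇔; Equivalence)
open import Function.Properties.Equivalence using () renaming (trans to ⇔-trans; sym to ⇔-sym)
open import Level using (0ℓ)
open import Relation.Binary.PropositionalEquality
open import Relation.Nullary using (Dec; yes; no; ¬_; does; ¬?; _×-dec_; _⊎-dec_)
open import Relation.Nullary.Decidable using (dec-true; decidable-stable)
open import Relation.Unary using (Pred; Decidable)

-- Binomial coefficients

C-monoˡ : ∀ {m n} k → m ≤ n → m C k ≤ n C k
C-monoˡ {m} k m≤n = go (≤⇒≤′ m≤n)
  where
  C-suc : ∀ n k → n C k ≤ suc n C k
  C-suc n zero = ≤-refl
  C-suc n (suc k) = ≤-trans (m≤n+m _ _) (≤-reflexive (nCk+nC[k+1]≡[n+1]C[k+1] n k))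
  go : ∀ {n} → m ≤′ n → m C k ≤ n C k
  go ≤′-refl = ≤-refl
  go (≤′-step m≤′n) = ≤-trans (go m≤′n) (C-suc _ k)

0<C : ∀ {n k} → k ≤ n → 0 < n C k
0<C {n} {zero} _ = s≤s z≤n
0<C {suc n} {suc k} (s≤s k≤n) =
  ≤-trans (0<C k≤n) (≤-trans (m≤m+n _ _) (≤-reflexive (nCk+nC[k+1]≡[n+1]C[k+1] n k)))

[1+n]Cn≡1+n : ∀ n → suc n C n ≡ suc n
[1+n]Cn≡1+n n = begin
  suc n C n           ≡⟨ nCk≡nC[n∸k] (n≤1+n n) ⟩
  suc n C (suc n ∸ n) ≡⟨ cong (suc n C_) (m+n∸n≡m 1 n) ⟩
  suc n C 1           ≡⟨ nC1≡n (suc n) ⟩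
  suc n               ∎
  where open ≡-Reasoning

C-absorption : ∀ n k → suc k * (suc n C suc k) ≡ suc n * (n C k)
C-absorption zero zero = refl
C-absorption zero (suc k) = begin
  suc (suc k) * (1 C suc (suc k)) ≡⟨ cong (suc (suc k) *_) (k>n⇒nCk≡0 {1} {suc (suc k)} (s≤s (s≤s z≤n))) ⟩
  suc (suc k) * 0                 ≡⟨ *-zeroʳ (suc (suc k)) ⟩
  0                               ≡⟨ cong (1 *_) (k>n⇒nCk≡0 {0} {suc k} (s≤s z≤n)) ⟨
  1 * (0 C suc k)                 ∎
  where open ≡-Reasoning
C-absorption (suc n) zero = begin
  1 * (suc (suc n) C 1) ≡⟨ *-identityˡ _ ⟩
  suc (suc n) C 1       ≡⟨ nC1≡n (suc (suc n)) ⟩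
  suc (suc n)           ≡⟨ *-identityʳ (suc (suc n)) ⟨
  suc (suc n) * 1       ∎
  where open ≡-Reasoning
C-absorption (suc n) (suc k) = begin
  suc (suc k) * (suc (suc n) C suc (suc k))   ≡⟨ cong (suc (suc k) *_) (pascal (suc n) (suc k)) ⟨
  suc (suc k) * (x + y)                       ≡⟨ split k x y ⟩
  (suc k * x + x) + suc (suc k) * y           ≡⟨ cong₂ (λ a b → (a + x) + b) (C-absorption n k) (C-absorption n (suc k)) ⟩
  (suc n * (n C k) + x) + suc n * (n C suc k) ≡⟨ gather n (n C k) (n C suc k) x ⟩
  suc n * (n C k + n C suc k) + x             ≡⟨ cong (λ z → suc n * z + x) (pascal n k) ⟩
  suc n * x + x                               ≡⟨ +-comm (suc n * x) x ⟩
  suc (suc n) * x                             ∎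
  where
  open ≡-Reasoning
  pascal = nCk+nC[k+1]≡[n+1]C[k+1]
  x = suc n C suc k
  y = suc n C suc (suc k)
  split : ∀ k x y → suc (suc k) * (x + y) ≡ (suc k * x + x) + suc (suc k) * y
  split = solve-∀
  gather : ∀ n a b x → (suc n * a + x) + suc n * b ≡ suc n * (a + b) + x
  gather = solve-∀

-- Counting families of subsets

count : ∀ {n} → Family n → ℕ
count {zero} F = if F [] then 1 else 0
count {suc n} F = count (λ S → F (inside ∷ S)) + count (λ S → F (outside ∷ S))

card≡count : ∀ {n} (F : Family n) → card F ≡ count F
card≡count {zero} F with F []
... | true = refl
... | false = refl
card≡count {suc n} F = begin
  length (filter P (map (inside ∷_) L ++ map (outside ∷_) L))
    ≡⟨ cong length (filter-++ P (map (inside ∷_) L) (map (outside ∷_) L)) ⟩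
  length (filter P (map (inside ∷_) L) ++ filter P (map (outside ∷_) L))
    ≡⟨ length-++ (filter P (map (inside ∷_) L)) ⟩
  length (filter P (map (inside ∷_) L)) + length (filter P (map (outside ∷_) L))
    ≡⟨ cong₂ _+_ (length-filter-map (inside ∷_) L) (length-filter-map (outside ∷_) L) ⟩
  card (λ S → F (inside ∷ S)) + card (λ S → F (outside ∷ S))
    ≡⟨ cong₂ _+_ (card≡count (λ S → F (inside ∷ S))) (card≡count (λ S → F (outside ∷ S))) ⟩
  count F ∎
  where
  open ≡-Reasoning
  L = allSubsets n
  P = λ S → T? (F S)
  length-filter-map : ∀ {m} (f : Subset m → Subset (suc n)) (xs : List (Subset m)) →
    length (filter P (map f xs)) ≡ length (filter (λ S → T? (F (f S))) xs)
  length-filter-map f [] = refl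
  length-filter-map f (x ∷ xs) with F (f x)
  ... | true = cong suc (length-filter-map f xs)
  ... | false = length-filter-map f xs

infix 4 _⊆ᶠ_
_⊆ᶠ_ : ∀ {n} → Family n → Family n → Set
F ⊆ᶠ G = ∀ S → F S ≡ true → G S ≡ true

count-mono : ∀ {n} {F G : Family n} → F ⊆ᶠ G → count F ≤ count G
count-mono {zero} {F} F⊆G with F [] in e
... | false = z≤n
... | true rewrite F⊆G [] e = ≤-refl
count-mono {suc n} F⊆G =
  +-mono-≤ (count-mono (λ S → F⊆G (inside ∷ S))) (count-mono (λ S → F⊆G (outside ∷ S)))

count-cong : ∀ {n} {F G : Family n} → (∀ S → F S ≡ G S) → count F ≡ count G
count-cong {zero} F≗G = cong (if_then 1 else 0) (F≗G [])
count-cong {suc n} F≗G =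
  cong₂ _+_ (count-cong (λ S → F≗G (inside ∷ S))) (count-cong (λ S → F≗G (outside ∷ S)))

count-empty : ∀ {n} {F : Family n} → (∀ S → F S ≡ false) → count F ≡ 0
count-empty {zero} {F} F≗∅ rewrite F≗∅ [] = refl
count-empty {suc n} F≗∅
  rewrite count-empty (λ S → F≗∅ (inside ∷ S)) | count-empty (λ S → F≗∅ (outside ∷ S)) = refl

count-∨ : ∀ {n} (F G : Family n) → count (λ S → F S ∨ G S) ≤ count F + count G
count-∨ {zero} F G with F []
... | true = s≤s z≤n
... | false = ≤-refl
count-∨ {suc n} F G = begin
  count (λ S → Fᵢ S ∨ Gᵢ S) + count (λ S → Fₒ S ∨ Gₒ S) ≤⟨ +-mono-≤ (count-∨ Fᵢ Gᵢ) (count-∨ Fₒ Gₒ) ⟩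
  (count Fᵢ + count Gᵢ) + (count Fₒ + count Gₒ)         ≡⟨ +-interchange (count Fᵢ) (count Gᵢ) (count Fₒ) (count Gₒ) ⟩
  (count Fᵢ + count Fₒ) + (count Gᵢ + count Gₒ)         ∎
  where
  open ≤-Reasoning
  Fᵢ Fₒ Gᵢ Gₒ : Family n
  Fᵢ S = F (inside ∷ S)
  Fₒ S = F (outside ∷ S)
  Gᵢ S = G (inside ∷ S)
  Gₒ S = G (outside ∷ S)

count-pos⇒member : ∀ {n} (F : Family n) → 0 < count F → ∃[ S ] F S ≡ true
count-pos⇒member {zero} F 0<count with F [] in e
... | true = [] , e
count-pos⇒member {suc n} F 0<count with count (λ S → F (inside ∷ S)) in e
... | suc _ = let (S , S∈F) = count-pos⇒member (λ S → F (inside ∷ S)) (subst (0 <_) (sym e) (s≤s z≤n))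
              in inside ∷ S , S∈F
... | zero = let (S , S∈F) = count-pos⇒member (λ S → F (outside ∷ S)) 0<count in outside ∷ S , S∈F

⊆ᶠ∧count≤⇒⊇ᶠ : ∀ {n} {F G : Family n} → F ⊆ᶠ G → count G ≤ count F → G ⊆ᶠ F
⊆ᶠ∧count≤⇒⊇ᶠ {zero} {F} F⊆G G≤F [] S∈G with F []
... | true = refl
... | false rewrite S∈G = ⊥-elim (1+n≰n G≤F)
⊆ᶠ∧count≤⇒⊇ᶠ {suc n} F⊆G G≤F (inside ∷ S) =
  ⊆ᶠ∧count≤⇒⊇ᶠ (λ S → F⊆G (inside ∷ S))
    (+-cancelʳ-≤ _ _ _ (≤-trans (+-monoʳ-≤ _ (count-mono λ S → F⊆G (outside ∷ S))) G≤F)) S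
⊆ᶠ∧count≤⇒⊇ᶠ {suc n} F⊆G G≤F (outside ∷ S) =
  ⊆ᶠ∧count≤⇒⊇ᶠ (λ S → F⊆G (outside ∷ S))
    (+-cancelˡ-≤ _ _ _ (≤-trans (+-monoˡ-≤ _ (count-mono λ S → F⊆G (inside ∷ S))) G≤F)) S

⋃ᶠ : ∀ {m n} → Family m → (Subset m → Family n) → Family n
⋃ᶠ P F S = does (anySubset? (λ T → T? (P T ∧ F T S)))

count-⋃ᶠ : ∀ {m n} (P : Family m) (F : Subset m → Family n) w c →
  (∀ T → P T ≡ true → w * count (F T) ≤ c) → w * count (⋃ᶠ P F) ≤ count P * c
count-⋃ᶠ {zero} P F w c bound with P [] in e
... | true = subst (w * count (F []) ≤_) (sym (+-identityʳ c)) (bound [] e)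
... | false = ≤-reflexive (trans (cong (w *_) (count-empty {F = λ S → false ∧ F [] S} λ _ → refl)) (*-zeroʳ w))
count-⋃ᶠ {suc m} {n} P F w c bound = begin
  w * count (λ S → ⋃ᶠ Pᵢ Fᵢ S ∨ ⋃ᶠ Pₒ Fₒ S)  ≤⟨ *-monoʳ-≤ w (count-∨ (⋃ᶠ Pᵢ Fᵢ) (⋃ᶠ Pₒ Fₒ)) ⟩
  w * (count (⋃ᶠ Pᵢ Fᵢ) + count (⋃ᶠ Pₒ Fₒ))  ≡⟨ *-distribˡ-+ w _ _ ⟩
  w * count (⋃ᶠ Pᵢ Fᵢ) + w * count (⋃ᶠ Pₒ Fₒ) ≤⟨ +-mono-≤ (count-⋃ᶠ Pᵢ Fᵢ w c (bound ∘ (inside ∷_)))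
                                                           (count-⋃ᶠ Pₒ Fₒ w c (bound ∘ (outside ∷_))) ⟩
  count Pᵢ * c + count Pₒ * c                 ≡⟨ *-distribʳ-+ c (count Pᵢ) (count Pₒ) ⟨
  (count Pᵢ + count Pₒ) * c                   ∎
  where
  open ≤-Reasoning
  Pᵢ Pₒ : Family m
  Pᵢ T = P (inside ∷ T)
  Pₒ T = P (outside ∷ T)
  Fᵢ Fₒ : Subset m → Family n
  Fᵢ T = F (inside ∷ T)
  Fₒ T = F (outside ∷ T)

-- A union bound, weighted by w so that it applies to (n − t) |F| without dividing by n − t.
count-cover : ∀ {m n} (P : Family m) (F : Subset m → Family n) (G : Family n) w c →
  (∀ S → G S ≡ true → ∃[ T ] P T ≡ true × F T S ≡ true) →
  (∀ T → P T ≡ true → w * count (F T) ≤ c) → w * count G ≤ count P * c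
count-cover P F G w c cover bound = ≤-trans (*-monoʳ-≤ w (count-mono G⊆⋃)) (count-⋃ᶠ P F w c bound)
  where
  G⊆⋃ : G ⊆ᶠ ⋃ᶠ P F
  G⊆⋃ S S∈G = let (T , T∈P , S∈FT) = cover S S∈G
              in dec-true (anySubset? _) (T , Equivalence.from T-≡ (cong₂ _∧_ T∈P S∈FT))

-- Intervals and stars

family : ∀ {n} {P : Pred (Subset n) 0ℓ} → Decidable P → Family n
family P? S = does (P? S)

family-member : ∀ {n} {P : Pred (Subset n) 0ℓ} (P? : Decidable P) S → family P? S ≡ true ⇔ P S
family-member P? S = does⇔ (P? S)
  where
  does⇔ : ∀ {A : Set} (a? : Dec A) → does a? ≡ true ⇔ A
  does⇔ (yes a) = mk⇔ (λ _ → a) (λ _ → refl)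
  does⇔ (no ¬a) = mk⇔ (λ ()) (⊥-elim ∘ ¬a)

interval : ∀ {n} → Subset n → Subset n → ℕ → Family n
interval u v s = family (λ S → ∣ S ∣ ≟ s ×-dec u ⊆? S ×-dec S ⊆? v)

interval-member : ∀ {n} (u v : Subset n) s S → interval u v s S ≡ true ⇔ (∣ S ∣ ≡ s × u ⊆ S × S ⊆ v)
interval-member u v s = family-member (λ S → ∣ S ∣ ≟ s ×-dec u ⊆? S ×-dec S ⊆? v)

count-interval-< : ∀ {n} {u v : Subset n} {s} → s < ∣ u ∣ → count (interval u v s) ≡ 0
count-interval-< {u = u} {v} {s} s<∣u∣ = count-empty λ S → ¬-not λ S∈I →
  let (∣S∣≡s , u⊆S , _) = Equivalence.to (interval-member u v s S) S∈I
  in <⇒≱ s<∣u∣ (subst (∣ u ∣ ≤_) ∣S∣≡s (p⊆q⇒∣p∣≤∣q∣ u⊆S))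

-- The size s = ∣ u ∣ + k is given by a hypothesis so that no truncated subtraction s ∸ ∣ u ∣ occurs.
count-interval : ∀ {n} {u v : Subset n} {s} k → u ⊆ v → ∣ u ∣ + k ≡ s →
  count (interval u v s) ≡ (∣ v ∣ ∸ ∣ u ∣) C k
count-interval {u = []} {[]} zero _ refl = refl
count-interval {u = []} {[]} (suc k) _ refl = refl
count-interval {u = inside ∷ u} {inside ∷ v} {s} k u⊆v refl =
  trans (cong₂ _+_ (count-interval k (drop-∷-⊆ u⊆v) refl)
                   (count-empty {F = λ S → interval (inside ∷ u) (inside ∷ v) s (outside ∷ S)} λ S → ∧-zeroʳ _))
        (+-identityʳ _)
count-interval {u = inside ∷ u} {outside ∷ v} k u⊆v e with u⊆v here
... | ()
count-interval {u = outside ∷ u} {outside ∷ v} {s} k u⊆v e =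
  cong₂ _+_ (count-empty {F = λ S → interval (outside ∷ u) (outside ∷ v) s (inside ∷ S)}
              λ S → trans (cong (does (suc ∣ S ∣ ≟ s) ∧_) (∧-zeroʳ (does (u ⊆? S)))) (∧-zeroʳ _))
            (count-interval k (drop-∷-⊆ u⊆v) e)
count-interval {u = outside ∷ u} {inside ∷ v} k u⊆v e =
  trans (pascal-step k e) (cong (_C k) (sym (+-∸-assoc 1 (p⊆q⇒∣p∣≤∣q∣ u⊆v′))))
  where
  u⊆v′ = drop-∷-⊆ u⊆v
  m = ∣ v ∣ ∸ ∣ u ∣
  pascal-step : ∀ {s} k → ∣ u ∣ + k ≡ s → count (interval (outside ∷ u) (inside ∷ v) s) ≡ suc m C k
  pascal-step {zero} zero e =
    cong₂ _+_ (count-empty {F = λ S → interval (outside ∷ u) (inside ∷ v) 0 (inside ∷ S)} λ _ → refl)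
              (count-interval zero u⊆v′ e)
  pascal-step {suc s} zero e =
    cong₂ _+_ (count-interval-< {u = u} {v} (≤-reflexive (trans (sym e) (+-identityʳ _))))
              (count-interval zero u⊆v′ e)
  pascal-step {zero} (suc k) e with trans (sym (+-suc ∣ u ∣ k)) e
  ... | ()
  pascal-step {suc s} (suc k) e = trans
    (cong₂ _+_ (count-interval k u⊆v′ (suc-injective (trans (sym (+-suc ∣ u ∣ k)) e)))
               (count-interval (suc k) u⊆v′ e))
    (nCk+nC[k+1]≡[n+1]C[k+1] m k)

count-subsets : ∀ {n} (X : Subset n) t → count (interval ⊥ X t) ≡ ∣ X ∣ C t
count-subsets {n} X t =
  trans (count-interval {u = ⊥} t (⊆-min X) (cong (_+ t) (∣⊥∣≡0 n))) (cong (λ m → (∣ X ∣ ∸ m) C t) (∣⊥∣≡0 n))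

star : ∀ {n} → ℕ → Subset n → Family n
star r T = interval T ⊤ r

star-member : ∀ {n} r (T S : Subset n) → star r T S ≡ true ⇔ (∣ S ∣ ≡ r × T ⊆ S)
star-member r T S = mk⇔ to from
  where
  to : star r T S ≡ true → ∣ S ∣ ≡ r × T ⊆ S
  to S∈star with Equivalence.to (interval-member T ⊤ r S) S∈star
  ... | ∣S∣≡r , T⊆S , _ = ∣S∣≡r , T⊆S
  from : ∣ S ∣ ≡ r × T ⊆ S → star r T S ≡ true
  from (∣S∣≡r , T⊆S) = Equivalence.from (interval-member T ⊤ r S) (∣S∣≡r , T⊆S , ⊆⊤)

count-star : ∀ {n r t} {T : Subset n} → ∣ T ∣ ≡ t → t ≤ r → count (star r T) ≡ (n ∸ t) C (r ∸ t)
count-star {n} {r} {t} {T} refl t≤r =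
  trans (count-interval {u = T} (r ∸ t) ⊆⊤ (m+[n∸m]≡n t≤r)) (cong (λ m → (m ∸ t) C (r ∸ t)) (∣⊤∣≡n n))

-- No hypothesis t < r is needed: when r ≤ t the star is empty and r ∸ t = 0.
star-suc-count : ∀ {n r t} {U : Subset n} → ∣ U ∣ ≡ suc t → t < n →
  (n ∸ t) * count (star r U) ≡ (r ∸ t) * ((n ∸ t) C (r ∸ t))
star-suc-count {n} {r} {t} {U} ∣U∣≡1+t t<n with t <? r
... | no t≮r = begin
  (n ∸ t) * count (star r U)     ≡⟨ cong ((n ∸ t) *_) (count-interval-< {u = U} (subst (r <_) (sym ∣U∣≡1+t) (s≤s (≮⇒≥ t≮r)))) ⟩
  (n ∸ t) * 0                    ≡⟨ *-zeroʳ (n ∸ t) ⟩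
  0                              ≡⟨ cong (_* ((n ∸ t) C (r ∸ t))) (m≤n⇒m∸n≡0 (≮⇒≥ t≮r)) ⟨
  (r ∸ t) * ((n ∸ t) C (r ∸ t))  ∎
  where open ≡-Reasoning
... | yes t<r = begin
  (n ∸ t) * count (star r U)     ≡⟨ cong₂ _*_ (+-∸-assoc 1 t<n) (count-star {T = U} ∣U∣≡1+t t<r) ⟩
  suc N * (N C K)                ≡⟨ C-absorption N K ⟨
  suc K * (suc N C suc K)        ≡⟨ cong₂ (λ a b → a * (b C a)) (+-∸-assoc 1 t<r) (+-∸-assoc 1 t<n) ⟨
  (r ∸ t) * ((n ∸ t) C (r ∸ t))  ∎
  where
  open ≡-Reasoning
  N = n ∸ suc t
  K = r ∸ suc t

_[⊇_] : ∀ {n} → Family n → Subset n → Family n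
F [⊇ T ] = family (λ S → F S Bool.≟ true ×-dec T ⊆? S)

[⊇]-member : ∀ {n} (F : Family n) T S → (F [⊇ T ]) S ≡ true ⇔ (F S ≡ true × T ⊆ S)
[⊇]-member F T = family-member (λ S → F S Bool.≟ true ×-dec T ⊆? S)

Uniform-⊆ᶠ : ∀ {n r} {F G : Family n} → F ⊆ᶠ G → Uniform r G → Uniform r F
Uniform-⊆ᶠ F⊆G G-unif S = G-unif S ∘ F⊆G S

⊆-∩ : ∀ {n} {u p q : Subset n} → u ⊆ p → u ⊆ q → u ⊆ p ∩ q
⊆-∩ u⊆p u⊆q x∈u = x∈p∩q⁺ (u⊆p x∈u , u⊆q x∈u)

∣p∪q∣≤∣p∣+∣q∣ : ∀ {n} (p q : Subset n) → ∣ p ∪ q ∣ ≤ ∣ p ∣ + ∣ q ∣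
∣p∪q∣≤∣p∣+∣q∣ [] [] = z≤n
∣p∪q∣≤∣p∣+∣q∣ (inside ∷ p) (b ∷ q) = s≤s (≤-trans (∣p∪q∣≤∣p∣+∣q∣ p q) (+-monoʳ-≤ ∣ p ∣ (∣p∣≤∣x∷p∣ b q)))
∣p∪q∣≤∣p∣+∣q∣ (outside ∷ p) (inside ∷ q) = ≤-trans (s≤s (∣p∪q∣≤∣p∣+∣q∣ p q)) (≤-reflexive (sym (+-suc ∣ p ∣ ∣ q ∣)))
∣p∪q∣≤∣p∣+∣q∣ (outside ∷ p) (outside ∷ q) = ∣p∪q∣≤∣p∣+∣q∣ p q

⊈⇒∃∉ : ∀ {n} {p q : Subset n} → p ⊈ q → ∃[ x ] x ∈ p × x ∉ q
⊈⇒∃∉ {n} {p} {q} p⊈q =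
  let (x , ¬[x∉p⊎x∈q]) = ¬∀⟶∃¬ n (λ x → x ∉ p ⊎ x ∈ q) (λ x → ¬? (x ∈? p) ⊎-dec x ∈? q)
                           (λ x∉p⊎x∈q → p⊈q λ {x} x∈p → [ (λ x∉p → ⊥-elim (x∉p x∈p)) , (λ x∈q → x∈q) ]′ (x∉p⊎x∈q x))
  in x , decidable-stable (x ∈? p) (¬[x∉p⊎x∈q] ∘ inj₁) , ¬[x∉p⊎x∈q] ∘ inj₂

extend : ∀ {n} {u x : Subset n} m → u ⊆ x → ∣ u ∣ ≤ m → m ≤ ∣ x ∣ → ∃[ U ] u ⊆ U × U ⊆ x × ∣ U ∣ ≡ m
extend {u = []} {[]} zero _ _ _ = [] , ⊆-refl , ⊆-refl , refl
extend {u = inside ∷ u} {inside ∷ x} (suc m) u⊆x (s≤s ∣u∣≤m) (s≤s m≤∣x∣) =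
  let (U , u⊆U , U⊆x , ∣U∣≡m) = extend m (drop-∷-⊆ u⊆x) ∣u∣≤m m≤∣x∣
  in inside ∷ U , s⊆s u⊆U , s⊆s U⊆x , cong suc ∣U∣≡m
extend {u = inside ∷ u} {outside ∷ x} m u⊆x _ _ with u⊆x here
... | ()
extend {u = outside ∷ u} {outside ∷ x} m u⊆x ∣u∣≤m m≤∣x∣ =
  let (U , u⊆U , U⊆x , ∣U∣≡m) = extend m (drop-∷-⊆ u⊆x) ∣u∣≤m m≤∣x∣
  in outside ∷ U , s⊆s u⊆U , s⊆s U⊆x , ∣U∣≡m
extend {u = outside ∷ u} {inside ∷ x} m u⊆x ∣u∣≤m m≤1+∣x∣ with m ≤? ∣ x ∣
... | yes m≤∣x∣ =
  let (U , u⊆U , U⊆x , ∣U∣≡m) = extend m (drop-∷-⊆ u⊆x) ∣u∣≤m m≤∣x∣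
  in outside ∷ U , s⊆s u⊆U , out⊆ U⊆x , ∣U∣≡m
... | no m≰∣x∣ = inside ∷ x , out⊆ (drop-∷-⊆ u⊆x) , ⊆-refl , ≤-antisym (≰⇒> m≰∣x∣) m≤1+∣x∣

subset-of-size : ∀ {n t} {X : Subset n} → t ≤ ∣ X ∣ → ∃[ T ] T ⊆ X × ∣ T ∣ ≡ t
subset-of-size {n} {t} {X} t≤∣X∣ =
  let (T , _ , T⊆X , ∣T∣≡t) = extend t (⊆-min X) (subst (_≤ t) (sym (∣⊥∣≡0 n)) z≤n) t≤∣X∣
  in T , T⊆X , ∣T∣≡t

∩-∪-grows : ∀ {n} {T S B : Subset n} → T ⊆ S → T ⊈ B → ∣ S ∩ B ∣ < ∣ S ∩ (T ∪ B) ∣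
∩-∪-grows {T = T} {S} {B} T⊆S T⊈B with ⊈⇒∃∉ T⊈B
... | x , x∈T , x∉B = p⊂q⇒∣p∣<∣q∣
  ( (λ y∈S∩B → let (y∈S , y∈B) = x∈p∩q⁻ S B y∈S∩B in x∈p∩q⁺ (y∈S , x∈p∪q⁺ (inj₂ y∈B)))
  , x , x∈p∩q⁺ (T⊆S x∈T , x∈p∪q⁺ (inj₁ x∈T)) , x∉B ∘ proj₂ ∘ x∈p∩q⁻ S B )

count-between : ∀ {n} (T B : Subset n) → count (interval T (T ∪ B) (suc ∣ T ∣)) ≤ ∣ B ∣
count-between T B = begin
  count (interval T (T ∪ B) (suc ∣ T ∣)) ≡⟨ count-interval {u = T} 1 (p⊆p∪q B) (+-comm ∣ T ∣ 1) ⟩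
  (∣ T ∪ B ∣ ∸ ∣ T ∣) C 1                 ≡⟨ nC1≡n _ ⟩
  ∣ T ∪ B ∣ ∸ ∣ T ∣                       ≤⟨ m≤n+o⇒m∸n≤o ∣ T ∪ B ∣ ∣ T ∣ (∣p∪q∣≤∣p∣+∣q∣ T B) ⟩
  ∣ B ∣                                   ∎
  where open ≤-Reasoning

-- Kernels and stars

infix 4 _⊆⋂_
_⊆⋂_ : ∀ {n} → Subset n → Family n → Set
T ⊆⋂ F = ∀ S → F S ≡ true → T ⊆ S

⊆⋂-or-escape : ∀ {n} (T : Subset n) (F : Family n) → T ⊆⋂ F ⊎ ∃[ S ] F S ≡ true × T ⊈ S
⊆⋂-or-escape T F with anySubset? (λ S → F S Bool.≟ true ×-dec ¬? (T ⊆? S))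
... | yes (S , S∈F , T⊈S) = inj₂ (S , S∈F , T⊈S)
... | no ∄ = inj₁ λ S S∈F → decidable-stable (T ⊆? S) λ T⊈S → ∄ (S , S∈F , T⊈S)

_⊆⋂?_ : ∀ {n} (T : Subset n) (F : Family n) → Dec (T ⊆⋂ F)
T ⊆⋂? F = [ yes , (λ (S , S∈F , T⊈S) → no λ T⊆⋂F → T⊈S (T⊆⋂F S S∈F)) ]′ (⊆⋂-or-escape T F)

no-kernel⇒escape : ∀ {n t} {F : Family n} → ¬ (∃[ T ] ∣ T ∣ ≡ t × T ⊆⋂ F) →
  ∀ T → ∣ T ∣ ≡ t → ∃[ S ] F S ≡ true × T ⊈ S
no-kernel⇒escape {F = F} ∄kernel T ∣T∣≡t with ⊆⋂-or-escape T F
... | inj₁ T⊆⋂F = ⊥-elim (∄kernel (T , ∣T∣≡t , T⊆⋂F))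
... | inj₂ escape = escape

⊆⋂⇒⊆ᶠstar : ∀ {n r} {F : Family n} {T} → Uniform r F → T ⊆⋂ F → F ⊆ᶠ star r T
⊆⋂⇒⊆ᶠstar {r = r} {T = T} F-unif T⊆⋂F S S∈F = Equivalence.from (star-member r T S) (F-unif S S∈F , T⊆⋂F S S∈F)

-- If x ∈ T′ ∖ T, extending T inside the complement of x gives a member of the star that misses x.
⊆⋂star⇒⊆ : ∀ {n r} {T T′ : Subset n} → ∣ T ∣ ≤ r → r < n → T′ ⊆⋂ star r T → T′ ⊆ T
⊆⋂star⇒⊆ {n} {r} {T} {T′} ∣T∣≤r r<n T′⊆⋂star {x} x∈T′ = decidable-stable (x ∈? T) x∉T-absurd
  where
  x∉T-absurd : ¬ x ∉ T
  x∉T-absurd x∉T =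
    let (U , T⊆U , U⊆∁⁅x⁆ , ∣U∣≡r) = extend r T⊆∁⁅x⁆ ∣T∣≤r r≤∣∁⁅x⁆∣
    in x∈p⇒x∉∁p (x∈⁅x⁆ x) (U⊆∁⁅x⁆ (T′⊆⋂star U (Equivalence.from (star-member r T U) (∣U∣≡r , T⊆U)) x∈T′))
    where
    T⊆∁⁅x⁆ : T ⊆ ∁ ⁅ x ⁆
    T⊆∁⁅x⁆ {y} y∈T = x∉p⇒x∈∁p (x≢y⇒x∉⁅y⁆ λ y≡x → x∉T (subst (_∈ T) y≡x y∈T))
    r≤∣∁⁅x⁆∣ : r ≤ ∣ ∁ ⁅ x ⁆ ∣
    r≤∣∁⁅x⁆∣ = subst (r ≤_) (sym (trans (∣∁p∣≡n∸∣p∣ ⁅ x ⁆) (cong (n ∸_) (∣⁅x⁆∣≡1 x)))) (∸-monoˡ-≤ 1 r<n)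

IsStar : ∀ {n} → ℕ → Subset n → Family n → Set
IsStar r T F = ∀ S → F S ≡ true ⇔ (∣ S ∣ ≡ r × T ⊆ S)

kernel-count : ∀ {n r t} {F : Family n} {T} → Uniform r F → ∣ T ∣ ≡ t → t ≤ r → T ⊆⋂ F →
  count F ≤ (n ∸ t) C (r ∸ t)
kernel-count {T = T} F-unif ∣T∣≡t t≤r T⊆⋂F =
  ≤-trans (count-mono (⊆⋂⇒⊆ᶠstar F-unif T⊆⋂F)) (≤-reflexive (count-star {T = T} ∣T∣≡t t≤r))

kernel-full-star : ∀ {n r t} {F : Family n} {T} → Uniform r F → ∣ T ∣ ≡ t → t ≤ r → T ⊆⋂ F →
  (n ∸ t) C (r ∸ t) ≤ count F → IsStar r T F
kernel-full-star {r = r} {F = F} {T} F-unif ∣T∣≡t t≤r T⊆⋂F star≤F S =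
  mk⇔ (Equivalence.to (star-member r T S) ∘ ⊆⋂⇒⊆ᶠstar F-unif T⊆⋂F S)
      (star⊆F S ∘ Equivalence.from (star-member r T S))
  where
  star⊆F : star r T ⊆ᶠ F
  star⊆F = ⊆ᶠ∧count≤⇒⊇ᶠ (⊆⋂⇒⊆ᶠstar F-unif T⊆⋂F) (subst (_≤ count F) (sym (count-star {T = T} ∣T∣≡t t≤r)) star≤F)

IsStar-count : ∀ {n r t} {F : Family n} {T} → ∣ T ∣ ≡ t → t ≤ r → IsStar r T F → count F ≡ (n ∸ t) C (r ∸ t)
IsStar-count {r = r} {T = T} ∣T∣≡t t≤r F-star =
  trans (count-cong λ S → ⇔→≡ (⇔-trans (F-star S) (⇔-sym (star-member r T S)))) (count-star {T = T} ∣T∣≡t t≤r)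

IsStar-unique : ∀ {n r t} {F : Family n} {T T′} → t ≤ r → r < n → ∣ T ∣ ≡ t → ∣ T′ ∣ ≡ t →
  IsStar r T F → IsStar r T′ F → T ≡ T′
IsStar-unique {r = r} {F = F} t≤r r<n ∣T∣≡t ∣T′∣≡t F-star F-star′ =
  ⊆-antisym (⊆⋂star⇒⊆ (subst (_≤ r) (sym ∣T′∣≡t) t≤r) r<n (⊆⋂star F-star F-star′))
            (⊆⋂star⇒⊆ (subst (_≤ r) (sym ∣T∣≡t) t≤r) r<n (⊆⋂star F-star′ F-star))
  where
  ⊆⋂star : ∀ {T T′} → IsStar r T F → IsStar r T′ F → T ⊆⋂ star r T′
  ⊆⋂star {T′ = T′} F-star F-star′ S S∈star =
    proj₂ (Equivalence.to (F-star S) (Equivalence.from (F-star′ S) (Equivalence.to (star-member r T′ S) S∈star)))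

-- Pairs of cross-t-intersecting families

Cross : ∀ {n} → ℕ → Family n → Family n → Set
Cross t F G = ∀ S S′ → F S ≡ true → G S′ ≡ true → t ≤ ∣ S ∩ S′ ∣

Cross-sym : ∀ {n t} {F G : Family n} → Cross t F G → Cross t G F
Cross-sym {t = t} cross S S′ S∈G S′∈F = subst (t ≤_) (cong ∣_∣ (∩-comm S′ S)) (cross S′ S S′∈F S∈G)

count-≤-trace : ∀ {n r t} {F : Family n} (X : Subset n) → Uniform r F → t ≤ r →
  (∀ S → F S ≡ true → t ≤ ∣ S ∩ X ∣) → count F ≤ (∣ X ∣ C t) * ((n ∸ t) C (r ∸ t))
count-≤-trace {n} {r} {t} {F} X F-unif t≤r meets = begin
  count F                     ≡⟨ *-identityˡ (count F) ⟨
  1 * count F                 ≤⟨ count-cover P (star r) F 1 c cover bound ⟩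
  count P * c                 ≡⟨ cong (_* c) (count-subsets X t) ⟩
  (∣ X ∣ C t) * c             ∎
  where
  open ≤-Reasoning
  c = (n ∸ t) C (r ∸ t)
  P = interval ⊥ X t
  cover : ∀ S → F S ≡ true → ∃[ T ] P T ≡ true × star r T S ≡ true
  cover S S∈F =
    let (T , T⊆S∩X , ∣T∣≡t) = subset-of-size (meets S S∈F)
    in T , Equivalence.from (interval-member ⊥ X t T) (∣T∣≡t , ⊆-min T , ⊆-trans T⊆S∩X (p∩q⊆q S X))
         , Equivalence.from (star-member r T S) (F-unif S S∈F , ⊆-trans T⊆S∩X (p∩q⊆p S X))
  bound : ∀ T → P T ≡ true → 1 * count (star r T) ≤ c
  bound T T∈P = ≤-reflexive (trans (*-identityˡ _)
                  (count-star {T = T} (proj₁ (Equivalence.to (interval-member ⊥ X t T) T∈P)) t≤r))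

count-≤-escape : ∀ {n r t} {F : Family n} {T B : Subset n} → t < n → ∣ T ∣ ≡ t → Uniform r F →
  T ⊆⋂ F → T ⊈ B → (∀ S → F S ≡ true → t ≤ ∣ S ∩ B ∣) →
  (n ∸ t) * count F ≤ ∣ B ∣ * (r ∸ t) * ((n ∸ t) C (r ∸ t))
count-≤-escape {n} {r} {t} {F} {T} {B} t<n refl F-unif T⊆⋂F T⊈B meets = begin
  (n ∸ t) * count F                      ≤⟨ count-cover P (star r) F (n ∸ t) c cover bound ⟩
  count P * c                            ≤⟨ *-monoˡ-≤ c (count-between T B) ⟩
  ∣ B ∣ * c                              ≡⟨ *-assoc ∣ B ∣ (r ∸ t) _ ⟨
  ∣ B ∣ * (r ∸ t) * ((n ∸ t) C (r ∸ t))  ∎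
  where
  open ≤-Reasoning
  c = (r ∸ t) * ((n ∸ t) C (r ∸ t))
  P = interval T (T ∪ B) (suc t)
  cover : ∀ S → F S ≡ true → ∃[ U ] P U ≡ true × star r U S ≡ true
  cover S S∈F =
    let (U , T⊆U , U⊆S∩[T∪B] , ∣U∣≡1+t) = extend (suc t) (⊆-∩ (T⊆⋂F S S∈F) (p⊆p∪q B)) (n≤1+n t)
                                              (≤-<-trans (meets S S∈F) (∩-∪-grows (T⊆⋂F S S∈F) T⊈B))
    in U , Equivalence.from (interval-member T (T ∪ B) (suc t) U)
                            (∣U∣≡1+t , T⊆U , ⊆-trans U⊆S∩[T∪B] (p∩q⊆q S (T ∪ B)))
         , Equivalence.from (star-member r U S) (F-unif S S∈F , ⊆-trans U⊆S∩[T∪B] (p∩q⊆p S (T ∪ B)))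
  bound : ∀ U → P U ≡ true → (n ∸ t) * count (star r U) ≤ c
  bound U U∈P =
    ≤-reflexive (star-suc-count {U = U} (proj₁ (Equivalence.to (interval-member T (T ∪ B) (suc t) U) U∈P)) t<n)

count-≤-no-kernel : ∀ {n r s t} {F G : Family n} {B₀ : Subset n} → t < n → Uniform r F → Uniform s G →
  Cross t F G → G B₀ ≡ true → (∀ T → ∣ T ∣ ≡ t → ∃[ B ] G B ≡ true × T ⊈ B) →
  (n ∸ t) * count F ≤ (s C t) * s * (r ∸ t) * ((n ∸ t) C (r ∸ t))
count-≤-no-kernel {n} {r} {s} {t} {F} {G} {B₀} t<n F-unif G-unif cross B₀∈G escape = begin
  (n ∸ t) * count F                            ≤⟨ count-cover P (F [⊇_]) F (n ∸ t) (s * c) cover bound ⟩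
  count P * (s * c)                            ≡⟨ cong (_* (s * c)) (trans (count-subsets B₀ t) (cong (_C t) (G-unif B₀ B₀∈G))) ⟩
  (s C t) * (s * c)                            ≡⟨ reassoc (s C t) s (r ∸ t) _ ⟩
  (s C t) * s * (r ∸ t) * ((n ∸ t) C (r ∸ t))  ∎
  where
  open ≤-Reasoning
  c = (r ∸ t) * ((n ∸ t) C (r ∸ t))
  P = interval ⊥ B₀ t
  reassoc : ∀ a b c d → a * (b * (c * d)) ≡ a * b * c * d
  reassoc = solve-∀
  cover : ∀ S → F S ≡ true → ∃[ T ] P T ≡ true × (F [⊇ T ]) S ≡ true
  cover S S∈F =
    let (T , T⊆S∩B₀ , ∣T∣≡t) = subset-of-size (cross S B₀ S∈F B₀∈G)
    in T , Equivalence.from (interval-member ⊥ B₀ t T) (∣T∣≡t , ⊆-min T , ⊆-trans T⊆S∩B₀ (p∩q⊆q S B₀))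
         , Equivalence.from ([⊇]-member F T S) (S∈F , ⊆-trans T⊆S∩B₀ (p∩q⊆p S B₀))
  bound : ∀ T → P T ≡ true → (n ∸ t) * count (F [⊇ T ]) ≤ s * c
  bound T T∈P with escape T (proj₁ (Equivalence.to (interval-member ⊥ B₀ t T) T∈P))
  ... | B , B∈G , T⊈B =
    subst (λ m → (n ∸ t) * count (F [⊇ T ]) ≤ m) (trans (cong (λ m → m * (r ∸ t) * _) (G-unif B B∈G)) (*-assoc s (r ∸ t) _))
      (count-≤-escape t<n (proj₁ (Equivalence.to (interval-member ⊥ B₀ t T) T∈P)) (Uniform-⊆ᶠ F[⊇T]⊆F F-unif)
                      T⊆⋂F[⊇T] T⊈B (λ S S∈F[⊇T] → cross S B (F[⊇T]⊆F S S∈F[⊇T]) B∈G))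
    where
    F[⊇T]⊆F : F [⊇ T ] ⊆ᶠ F
    F[⊇T]⊆F S = proj₁ ∘ Equivalence.to ([⊇]-member F T S)
    T⊆⋂F[⊇T] : T ⊆⋂ F [⊇ T ]
    T⊆⋂F[⊇T] S = proj₂ ∘ Equivalence.to ([⊇]-member F T S)

product-< : ∀ N x y {a b c d} → N * a ≤ x * c → N * b ≤ y * d → x * y < N * N → 0 < c → 0 < d → a * b < c * d
product-< N x y {a} {b} {c} {d} Na≤xc Nb≤yd xy<NN 0<c 0<d = *-cancelˡ-< (N * N) (a * b) (c * d) (begin-strict
  N * N * (a * b)  ≡⟨ *-interchange N N a b ⟩
  N * a * (N * b)  ≤⟨ *-mono-≤ Na≤xc Nb≤yd ⟩
  x * c * (y * d)  ≡⟨ *-interchange x c y d ⟩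
  x * y * (c * d)  <⟨ *-monoˡ-< (c * d) {{>-nonZero (*-mono-≤ 0<c 0<d)}} xy<NN ⟩
  N * N * (c * d)  ∎)
  where open ≤-Reasoning

-- The pair bound below needs pairWeight t r s and pairWeight t s r to be less than n − t;
-- n₀ is chosen to guarantee this for every pair of the k families.
pairWeight : ℕ → ℕ → ℕ → ℕ
pairWeight t r s = s * (r ∸ t) * (r C t)

module CrossPair {n t r s : ℕ} {A B : Family n} (t≤r : t ≤ r) (t≤s : t ≤ s) (r<n : r < n) (s<n : s < n)
                 (A-unif : Uniform r A) (B-unif : Uniform s B) (cross : Cross t A B) where

  private
    N = n ∸ t
    t<n : t < n
    t<n = ≤-<-trans t≤r r<n
    0<C[N,r-t] : 0 < N C (r ∸ t)
    0<C[N,r-t] = 0<C (∸-monoˡ-≤ t (<⇒≤ r<n))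
    0<C[N,s-t] : 0 < N C (s ∸ t)
    0<C[N,s-t] = 0<C (∸-monoˡ-≤ t (<⇒≤ s<n))

  kernel-escape-< : ∀ {A₀ T B′} → pairWeight t r s < N → A A₀ ≡ true → ∣ T ∣ ≡ t → T ⊆⋂ A →
    B B′ ≡ true → T ⊈ B′ → count A * count B < (N C (r ∸ t)) * (N C (s ∸ t))
  kernel-escape-< {A₀} {T} {B′} w<N A₀∈A ∣T∣≡t T⊆⋂A B′∈B T⊈B′ =
    product-< N (s * (r ∸ t)) (N * (r C t)) NA≤ NB≤
      (subst (_< N * N) (reorder s (r ∸ t) (r C t) N) (*-monoˡ-< N {{>-nonZero (≤-<-trans z≤n w<N)}} w<N))
      0<C[N,r-t] 0<C[N,s-t]
    where
    reorder : ∀ s d c N → s * d * c * N ≡ s * d * (N * c)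
    reorder = solve-∀
    NA≤ : N * count A ≤ s * (r ∸ t) * (N C (r ∸ t))
    NA≤ = subst (λ m → N * count A ≤ m * (r ∸ t) * (N C (r ∸ t))) (B-unif B′ B′∈B)
            (count-≤-escape t<n ∣T∣≡t A-unif T⊆⋂A T⊈B′ (λ S S∈A → cross S B′ S∈A B′∈B))
    B≤ : count B ≤ (r C t) * (N C (s ∸ t))
    B≤ = subst (λ m → count B ≤ (m C t) * (N C (s ∸ t))) (A-unif A₀ A₀∈A)
           (count-≤-trace A₀ B-unif t≤s (λ S S∈B → Cross-sym cross S A₀ S∈B A₀∈A))
    NB≤ : N * count B ≤ N * (r C t) * (N C (s ∸ t))
    NB≤ = ≤-trans (*-monoʳ-≤ N B≤) (≤-reflexive (sym (*-assoc N (r C t) _)))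

  no-kernel-< : ∀ {A₀ B₀} → pairWeight t r s < N → pairWeight t s r < N → A A₀ ≡ true → B B₀ ≡ true →
    (∀ T → ∣ T ∣ ≡ t → ∃[ S ] A S ≡ true × T ⊈ S) → (∀ T → ∣ T ∣ ≡ t → ∃[ S ] B S ≡ true × T ⊈ S) →
    count A * count B < (N C (r ∸ t)) * (N C (s ∸ t))
  no-kernel-< w<N w′<N A₀∈A B₀∈B escape-A escape-B =
    product-< N ((s C t) * s * (r ∸ t)) ((r C t) * r * (s ∸ t))
      (count-≤-no-kernel t<n A-unif B-unif cross B₀∈B escape-B)
      (count-≤-no-kernel t<n B-unif A-unif (Cross-sym cross) A₀∈A escape-A)
      (subst (_< N * N) (reorder s (r ∸ t) (r C t) r (s ∸ t) (s C t)) (*-mono-< w<N w′<N))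
      0<C[N,r-t] 0<C[N,s-t]
    where
    reorder : ∀ s d c r e c′ → s * d * c * (r * e * c′) ≡ c′ * s * d * (c * r * e)
    reorder = solve-∀

  kernel-or-< : ∀ {A₀ T} → pairWeight t r s < N → A A₀ ≡ true → ∣ T ∣ ≡ t → T ⊆⋂ A →
    (∃[ T ] ∣ T ∣ ≡ t × T ⊆⋂ A × T ⊆⋂ B) ⊎ count A * count B < (N C (r ∸ t)) * (N C (s ∸ t))
  kernel-or-< {T = T} w<N A₀∈A ∣T∣≡t T⊆⋂A with ⊆⋂-or-escape T B
  ... | inj₁ T⊆⋂B = inj₁ (T , ∣T∣≡t , T⊆⋂A , T⊆⋂B)
  ... | inj₂ (B′ , B′∈B , T⊈B′) = inj₂ (kernel-escape-< w<N A₀∈A ∣T∣≡t T⊆⋂A B′∈B T⊈B′)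

cross-pair : ∀ {n t r s} {A B : Family n} {A₀ B₀} → t ≤ r → t ≤ s → r < n → s < n →
  Uniform r A → Uniform s B → Cross t A B → pairWeight t r s < n ∸ t → pairWeight t s r < n ∸ t →
  A A₀ ≡ true → B B₀ ≡ true →
  (∃[ T ] ∣ T ∣ ≡ t × T ⊆⋂ A × T ⊆⋂ B) ⊎ count A * count B < ((n ∸ t) C (r ∸ t)) * ((n ∸ t) C (s ∸ t))
cross-pair {n} {t} {r} {s} {A} {B} t≤r t≤s r<n s<n A-unif B-unif cross w<N w′<N A₀∈A B₀∈B
  with anySubset? (λ T → ∣ T ∣ ≟ t ×-dec T ⊆⋂? A) | anySubset? (λ T → ∣ T ∣ ≟ t ×-dec T ⊆⋂? B)
... | yes (T , ∣T∣≡t , T⊆⋂A) | _ = AB.kernel-or-< w<N A₀∈A ∣T∣≡t T⊆⋂A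
  where module AB = CrossPair t≤r t≤s r<n s<n A-unif B-unif cross
... | no _ | yes (T , ∣T∣≡t , T⊆⋂B) =
  Sum.map (λ (T , ∣T∣≡t , T⊆⋂B , T⊆⋂A) → T , ∣T∣≡t , T⊆⋂A , T⊆⋂B)
          (subst₂ _<_ (*-comm (count B) (count A)) (*-comm ((n ∸ t) C (s ∸ t)) _))
          (BA.kernel-or-< w′<N B₀∈B ∣T∣≡t T⊆⋂B)
  where module BA = CrossPair t≤s t≤r s<n r<n B-unif A-unif (Cross-sym cross)
... | no ∄A | no ∄B = inj₂ (AB.no-kernel-< w<N w′<N A₀∈A B₀∈B (no-kernel⇒escape ∄A) (no-kernel⇒escape ∄B))
  where module AB = CrossPair t≤r t≤s r<n s<n A-unif B-unif cross

-- The threshold n₀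

module _ {R S t n : ℕ} (t≤R : t ≤ R) (R≤S : R ≤ S) (n₀≤n : n0 R S t ≤ n) where

  private
    M = R + S ∸ t
    X = R * (S ∸ t) * (M C t)
    Y = (R ∸ t) * (R C t) * (M C (t + 1))

    M≡[R-t]+S : M ≡ (R ∸ t) + S
    M≡[R-t]+S = +-∸-comm S t≤R

    S≤M : S ≤ M
    S≤M = subst (S ≤_) (sym M≡[R-t]+S) (m≤n+m S (R ∸ t))

    <n∸t : ∀ {x} → x ≤ X ⊔ Y → x < n ∸ t
    <n∸t {x} x≤X⊔Y = subst (_< n ∸ t) (m+n∸n≡m x t)
      (∸-monoˡ-< (subst (_≤ n) (+-comm (x + t) 1) (≤-trans (+-monoˡ-≤ 1 (+-monoˡ-≤ t x≤X⊔Y)) n₀≤n))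
                 (m≤n+m t x))

    S[R-t]C[S,t]≤Y : S * (R ∸ t) * (S C t) ≤ Y
    S[R-t]C[S,t]≤Y with t <? R
    ... | no t≮R rewrite m≤n⇒m∸n≡0 (≮⇒≥ t≮R) | *-zeroʳ S = z≤n
    ... | yes t<R = begin
      S * (R ∸ t) * (S C t)               ≡⟨ trans (cong (_* (S C t)) (*-comm S (R ∸ t))) (*-assoc (R ∸ t) S (S C t)) ⟩
      (R ∸ t) * (S * (S C t))             ≤⟨ *-monoʳ-≤ (R ∸ t) (*-monoˡ-≤ (S C t) (n≤1+n S)) ⟩
      (R ∸ t) * (suc S * (S C t))         ≡⟨ cong ((R ∸ t) *_) (C-absorption S t) ⟨
      (R ∸ t) * (suc t * (suc S C suc t)) ≤⟨ *-monoʳ-≤ (R ∸ t) (*-mono-≤ 1+t≤C[R,t] (C-monoˡ (suc t) 1+S≤M)) ⟩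
      (R ∸ t) * ((R C t) * (M C suc t))   ≡⟨ cong (λ k → (R ∸ t) * ((R C t) * (M C k))) (+-comm 1 t) ⟩
      (R ∸ t) * ((R C t) * (M C (t + 1))) ≡⟨ *-assoc (R ∸ t) (R C t) _ ⟨
      Y                                   ∎
      where
      open ≤-Reasoning
      1+t≤C[R,t] : suc t ≤ R C t
      1+t≤C[R,t] = subst (_≤ R C t) ([1+n]Cn≡1+n t) (C-monoˡ t t<R)
      1+S≤M : suc S ≤ M
      1+S≤M = subst (suc S ≤_) (sym M≡[R-t]+S) (+-monoˡ-≤ S (m<n⇒0<n∸m t<R))

  n₀-pairWeight : ∀ {a b} → a ≤ S → b ≤ S → a ≤ R ⊎ b ≤ R → pairWeight t a b < n ∸ t
  n₀-pairWeight {a} {b} a≤S b≤S (inj₁ a≤R) = <n∸t (begin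
    b * (a ∸ t) * (a C t)  ≤⟨ *-mono-≤ (*-mono-≤ b≤S (∸-monoˡ-≤ t a≤R)) (C-monoˡ t (≤-trans a≤R R≤S)) ⟩
    S * (R ∸ t) * (S C t)  ≤⟨ S[R-t]C[S,t]≤Y ⟩
    Y                      ≤⟨ m≤n⊔m X Y ⟩
    X ⊔ Y                  ∎)
    where open ≤-Reasoning
  n₀-pairWeight {a} {b} a≤S b≤S (inj₂ b≤R) = <n∸t (begin
    b * (a ∸ t) * (a C t)  ≤⟨ *-mono-≤ (*-mono-≤ b≤R (∸-monoˡ-≤ t a≤S)) (C-monoˡ t (≤-trans a≤S S≤M)) ⟩
    X                      ≤⟨ m≤m⊔n X Y ⟩
    X ⊔ Y                  ∎)
    where open ≤-Reasoning

  n₀-largest : 1 ≤ R → S < n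
  n₀-largest 1≤R =
    subst (_< n) (m∸n+n≡m (≤-trans t≤R R≤S)) (subst (S ∸ t + t <_) (m∸n+n≡m t≤n) (+-monoˡ-< t S-t<n-t))
    where
    open ≤-Reasoning
    t≤n : t ≤ n
    t≤n = ≤-trans (m≤n+m t (X ⊔ Y)) (≤-trans (m≤m+n _ 1) n₀≤n)
    S-t<n-t : S ∸ t < n ∸ t
    S-t<n-t = <n∸t (begin
      S ∸ t        ≤⟨ m≤n*m (S ∸ t) R {{>-nonZero 1≤R}} ⟩
      R * (S ∸ t)  ≤⟨ m≤m*n (R * (S ∸ t)) (M C t) {{>-nonZero (0<C (≤-trans (≤-trans t≤R R≤S) S≤M))}} ⟩
      X            ≤⟨ m≤m⊔n X Y ⟩
      X ⊔ Y        ∎)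

prod-cong : ∀ k {f g : Fin k → ℕ} → (∀ i → f i ≡ g i) → prod k f ≡ prod k g
prod-cong zero f≗g = refl
prod-cong (suc k) f≗g = cong₂ _*_ (f≗g fzero) (prod-cong k (f≗g ∘ fsuc))

prod-mono : ∀ k {f g : Fin k → ℕ} → (∀ i → f i ≤ g i) → prod k f ≤ prod k g
prod-mono zero f≤g = ≤-refl
prod-mono (suc k) f≤g = *-mono-≤ (f≤g fzero) (prod-mono k (f≤g ∘ fsuc))

prod-pos : ∀ k {f : Fin k → ℕ} → (∀ i → 0 < f i) → 0 < prod k f
prod-pos zero 0<f = s≤s z≤n
prod-pos (suc k) 0<f = *-mono-≤ (0<f fzero) (prod-pos k (0<f ∘ fsuc))

prod-pos⁻¹ : ∀ k {f : Fin k → ℕ} → 0 < prod k f → ∀ i → 0 < f i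
prod-pos⁻¹ (suc k) {f} 0<prod fzero =
  >-nonZero⁻¹ (f fzero) {{m*n≢0⇒m≢0 (f fzero) {{>-nonZero 0<prod}}}}
prod-pos⁻¹ (suc k) {f} 0<prod (fsuc i) =
  prod-pos⁻¹ k (>-nonZero⁻¹ _ {{m*n≢0⇒n≢0 (f fzero) {{>-nonZero 0<prod}}}}) i

*-≡⇒≡ˡ : ∀ {a b c d} → a ≤ c → b ≤ d → 0 < d → a * b ≡ c * d → a ≡ c
*-≡⇒≡ˡ {a} {b} {c} {d} a≤c b≤d 0<d ab≡cd with a <? c
... | no a≮c = ≤-antisym a≤c (≮⇒≥ a≮c)
... | yes a<c = ⊥-elim (<-irrefl ab≡cd (≤-<-trans (*-monoʳ-≤ a b≤d) (*-monoˡ-< d {{>-nonZero 0<d}} a<c)))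

prod-≡⇒≡ : ∀ k {f g : Fin k → ℕ} → (∀ i → f i ≤ g i) → (∀ i → 0 < g i) → prod k f ≡ prod k g → ∀ i → f i ≡ g i
prod-≡⇒≡ (suc k) {f} {g} f≤g 0<g prod≡ = ∀-cons f₀≡g₀
  (prod-≡⇒≡ k (f≤g ∘ fsuc) (0<g ∘ fsuc)
    (*-cancelˡ-≡ _ _ (g fzero) {{>-nonZero (0<g fzero)}} (trans (cong (_* _) (sym f₀≡g₀)) prod≡)))
  where
  f₀≡g₀ = *-≡⇒≡ˡ (f≤g fzero) (prod-mono k (f≤g ∘ fsuc)) (prod-pos k (0<g ∘ fsuc)) prod≡

PairwiseBounded : ∀ {k} → (Fin k → ℕ) → (Fin k → ℕ) → Set
PairwiseBounded a c = ∀ i j → i ≢ j → (a i ≤ c i × a j ≤ c j) ⊎ a i * a j < c i * c j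

pairwise-prod : ∀ m {a c : Fin (suc (suc m)) → ℕ} → (∀ i → 0 < c i) → PairwiseBounded a c →
  (∀ i → a i ≤ c i) ⊎ prod (suc (suc m)) a < prod (suc (suc m)) c

pairwise-prod-head : ∀ m {a c : Fin (suc (suc m)) → ℕ} → (∀ i → 0 < c i) → PairwiseBounded a c →
  a fzero ≤ c fzero → (∀ i → a i ≤ c i) ⊎ prod (suc (suc m)) a < prod (suc (suc m)) c
pairwise-prod-head zero {a} {c} 0<c bounded a₀≤c₀ with bounded fzero (fsuc fzero) (λ ())
... | inj₁ (_ , a₁≤c₁) = inj₁ (∀-cons a₀≤c₀ (∀-cons a₁≤c₁ λ ()))
... | inj₂ a₀a₁<c₀c₁ = inj₂ (subst₂ _<_ (cong (a fzero *_) (sym (*-identityʳ _)))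
                                      (cong (c fzero *_) (sym (*-identityʳ _))) a₀a₁<c₀c₁)
pairwise-prod-head (suc m) {a} {c} 0<c bounded a₀≤c₀
  with pairwise-prod m (0<c ∘ fsuc) (λ i j i≢j → bounded (fsuc i) (fsuc j) (i≢j ∘ fsuc-injective))
... | inj₁ tail≤ = inj₁ (∀-cons a₀≤c₀ tail≤)
... | inj₂ tail< = inj₂ (≤-<-trans (*-monoˡ-≤ _ a₀≤c₀) (*-monoʳ-< (c fzero) {{>-nonZero (0<c fzero)}} tail<))

-- If a₀ > c₀ then every pair (0, j) is strict, which forces a_j < c_j for all j ≠ 0.
pairwise-prod m {a} {c} 0<c bounded with a fzero ≤? c fzero
... | yes a₀≤c₀ = pairwise-prod-head m 0<c bounded a₀≤c₀
... | no a₀≰c₀ = inj₂ (begin-strict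
  a₀ * (a₁ * R)   ≡⟨ *-assoc a₀ a₁ R ⟨
  a₀ * a₁ * R     ≤⟨ *-monoʳ-≤ (a₀ * a₁) (prod-mono m (<⇒≤ ∘ tail-< ∘ fsuc)) ⟩
  a₀ * a₁ * R′    <⟨ *-monoˡ-< R′ {{>-nonZero (prod-pos m (0<c ∘ fsuc ∘ fsuc))}} (head-pair-< fzero) ⟩
  c₀ * c₁ * R′    ≡⟨ *-assoc c₀ c₁ R′ ⟩
  c₀ * (c₁ * R′)  ∎)
  where
  open ≤-Reasoning
  a₀ = a fzero
  a₁ = a (fsuc fzero)
  c₀ = c fzero
  c₁ = c (fsuc fzero)
  R = prod m (a ∘ fsuc ∘ fsuc)
  R′ = prod m (c ∘ fsuc ∘ fsuc)
  head-pair-< : ∀ j → a₀ * a (fsuc j) < c₀ * c (fsuc j)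
  head-pair-< j with bounded fzero (fsuc j) (λ ())
  ... | inj₁ (a₀≤c₀ , _) = ⊥-elim (a₀≰c₀ a₀≤c₀)
  ... | inj₂ a₀aⱼ<c₀cⱼ = a₀aⱼ<c₀cⱼ
  tail-< : ∀ j → a (fsuc j) < c (fsuc j)
  tail-< j with a (fsuc j) <? c (fsuc j)
  ... | yes aⱼ<cⱼ = aⱼ<cⱼ
  ... | no aⱼ≮cⱼ = ⊥-elim (<⇒≱ (head-pair-< j) (*-mono-≤ (<⇒≤ (≰⇒> a₀≰c₀)) (≮⇒≥ aⱼ≮cⱼ)))

≤-from-pos : ∀ {x y} → (0 < x → x ≤ y) → x ≤ y
≤-from-pos {zero} _ = z≤n
≤-from-pos {suc x} pos⇒≤ = pos⇒≤ (s≤s z≤n)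

≢lastIx⇒≤penultIx : ∀ m (i : Fin (suc (suc m))) → i ≢ lastIx m → i ≤ᶠ penultIx m
≢lastIx⇒≤penultIx m fzero _ = z≤n
≢lastIx⇒≤penultIx zero (fsuc fzero) i≢last = ⊥-elim (i≢last refl)
≢lastIx⇒≤penultIx (suc m) (fsuc i) i≢last = s≤s (≢lastIx⇒≤penultIx m i (i≢last ∘ cong fsuc))

-- The k families

module CrossIntersectingFamilies (m t n : ℕ) (r : Fin (suc (suc m)) → ℕ)
  (1≤r : ∀ i → 1 ≤ r i) (t≤r : ∀ i → t ≤ r i) (r-mono : ∀ i j → i ≤ᶠ j → r i ≤ r j)
  (n₀≤n : n0 (r (penultIx m)) (r (lastIx m)) t ≤ n)
  (𝓐 : Fin (suc (suc m)) → Family n) (𝓐-unif : ∀ i → Uniform (r i) (𝓐 i)) (cross : CrossIntersecting t 𝓐) where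

  k = suc (suc m)

  ∣𝓐∣ starSize : Fin k → ℕ
  ∣𝓐∣ i = count (𝓐 i)
  starSize i = (n ∸ t) C (r i ∸ t)

  private
    R : ℕ
    R = r (penultIx m)
    r≤last : ∀ i → r i ≤ r (lastIx m)
    r≤last i = r-mono i (lastIx m) (≤fromℕ i)

  r<n : ∀ i → r i < n
  r<n i = ≤-<-trans (r≤last i) (n₀-largest (t≤r (penultIx m)) (r≤last (penultIx m)) n₀≤n (1≤r (penultIx m)))

  0<starSize : ∀ i → 0 < starSize i
  0<starSize i = 0<C (∸-monoˡ-≤ t (<⇒≤ (r<n i)))

  pairWeight< : ∀ i j → i ≢ j → pairWeight t (r i) (r j) < n ∸ t
  pairWeight< i j i≢j = n₀-pairWeight (t≤r (penultIx m)) (r≤last (penultIx m)) n₀≤n (r≤last i) (r≤last j) one-≤R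
    where
    one-≤R : r i ≤ R ⊎ r j ≤ R
    one-≤R with i Fin.≟ lastIx m
    ... | yes refl = inj₂ (r-mono j (penultIx m) (≢lastIx⇒≤penultIx m j (i≢j ∘ sym)))
    ... | no i≢last = inj₁ (r-mono i (penultIx m) (≢lastIx⇒≤penultIx m i i≢last))

  pair : ∀ {A₀ B₀} i j → i ≢ j → 𝓐 i A₀ ≡ true → 𝓐 j B₀ ≡ true →
    (∃[ T ] ∣ T ∣ ≡ t × T ⊆⋂ 𝓐 i × T ⊆⋂ 𝓐 j) ⊎ ∣𝓐∣ i * ∣𝓐∣ j < starSize i * starSize j
  pair i j i≢j = cross-pair (t≤r i) (t≤r j) (r<n i) (r<n j) (𝓐-unif i) (𝓐-unif j) (cross i j i≢j)
                            (pairWeight< i j i≢j) (pairWeight< j i (i≢j ∘ sym))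

  nonempty : 0 < prod k ∣𝓐∣ → ∀ i → ∃[ A ] 𝓐 i A ≡ true
  nonempty 0<prod i = count-pos⇒member (𝓐 i) (prod-pos⁻¹ k {∣𝓐∣} 0<prod i)

  pairwise-bounded : 0 < prod k ∣𝓐∣ → PairwiseBounded ∣𝓐∣ starSize
  pairwise-bounded 0<prod i j i≢j with pair i j i≢j (proj₂ (nonempty 0<prod i)) (proj₂ (nonempty 0<prod j))
  ... | inj₁ (T , ∣T∣≡t , T⊆⋂𝓐ᵢ , T⊆⋂𝓐ⱼ) =
    inj₁ (kernel-count (𝓐-unif i) ∣T∣≡t (t≤r i) T⊆⋂𝓐ᵢ , kernel-count (𝓐-unif j) ∣T∣≡t (t≤r j) T⊆⋂𝓐ⱼ)
  ... | inj₂ ij< = inj₂ ij<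

  prod-bound : prod k ∣𝓐∣ ≤ prod k starSize
  prod-bound = ≤-from-pos λ 0<prod →
    [ prod-mono k , <⇒≤ ]′ (pairwise-prod m 0<starSize (pairwise-bounded 0<prod))

  module Extremal (prod≡ : prod k ∣𝓐∣ ≡ prod k starSize) where

    private
      0<prod : 0 < prod k ∣𝓐∣
      0<prod = subst (0 <_) (sym prod≡) (prod-pos k 0<starSize)

    ∣𝓐∣≡starSize : ∀ i → ∣𝓐∣ i ≡ starSize i
    ∣𝓐∣≡starSize with pairwise-prod m 0<starSize (pairwise-bounded 0<prod)
    ... | inj₁ ∣𝓐∣≤ = prod-≡⇒≡ k ∣𝓐∣≤ 0<starSize prod≡
    ... | inj₂ prod< = ⊥-elim (<-irrefl prod≡ prod<)

    common-kernel : ∀ i j → i ≢ j → ∃[ T ] ∣ T ∣ ≡ t × T ⊆⋂ 𝓐 i × T ⊆⋂ 𝓐 j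
    common-kernel i j i≢j with pair i j i≢j (proj₂ (nonempty 0<prod i)) (proj₂ (nonempty 0<prod j))
    ... | inj₁ kernel = kernel
    ... | inj₂ ij< = ⊥-elim (<-irrefl (cong₂ _*_ (∣𝓐∣≡starSize i) (∣𝓐∣≡starSize j)) ij<)

    kernel-star : ∀ i {T} → ∣ T ∣ ≡ t → T ⊆⋂ 𝓐 i → IsStar (r i) T (𝓐 i)
    kernel-star i ∣T∣≡t T⊆⋂𝓐ᵢ =
      kernel-full-star (𝓐-unif i) ∣T∣≡t (t≤r i) T⊆⋂𝓐ᵢ (≤-reflexive (sym (∣𝓐∣≡starSize i)))

    common-star : ∃[ T ] ∣ T ∣ ≡ t × (∀ i → IsStar (r i) T (𝓐 i))
    common-star with common-kernel fzero (fsuc fzero) (λ ())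
    ... | T , ∣T∣≡t , T⊆⋂𝓐₀ , _ = T , ∣T∣≡t , star-at
      where
      star-at : ∀ i → IsStar (r i) T (𝓐 i)
      star-at fzero = kernel-star fzero ∣T∣≡t T⊆⋂𝓐₀
      star-at (fsuc i) with common-kernel fzero (fsuc i) (λ ())
      ... | K , ∣K∣≡t , K⊆⋂𝓐₀ , K⊆⋂𝓐ᵢ =
        subst (λ K → IsStar (r (fsuc i)) K (𝓐 (fsuc i)))
              (IsStar-unique (t≤r fzero) (r<n fzero) ∣K∣≡t ∣T∣≡t
                             (kernel-star fzero ∣K∣≡t K⊆⋂𝓐₀) (kernel-star fzero ∣T∣≡t T⊆⋂𝓐₀))
              (kernel-star (fsuc i) ∣K∣≡t K⊆⋂𝓐ᵢ)

  star⇒prod≡ : ∃[ T ] ∣ T ∣ ≡ t × (∀ i → IsStar (r i) T (𝓐 i)) → prod k ∣𝓐∣ ≡ prod k starSize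
  star⇒prod≡ (T , ∣T∣≡t , 𝓐-star) = prod-cong k λ i → IsStar-count {T = T} ∣T∣≡t (t≤r i) (𝓐-star i)

theorem2 : (m t n : ℕ) (r : Fin (suc (suc m)) → ℕ) →
    1 ≤ t →
    (∀ i → 1 ≤ r i) →
    (∀ i → t ≤ r i) →
    (∀ i j → i ≤ᶠ j → r i ≤ r j) →
    n0 (r (penultIx m)) (r (lastIx m)) t ≤ n →
    (𝓐 : Fin (suc (suc m)) → Family n) →
    (∀ i → Uniform (r i) (𝓐 i)) →
    CrossIntersecting t 𝓐 →
    (prod (suc (suc m)) (λ i → card (𝓐 i)) ≤ prod (suc (suc m)) (λ i → (n ∸ t) C (r i ∸ t)))
    × (prod (suc (suc m)) (λ i → card (𝓐 i)) ≡ prod (suc (suc m)) (λ i → (n ∸ t) C (r i ∸ t))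
       ⇔ (∃[ T ] (∣ T ∣ ≡ t × (∀ i (A : Subset n) → (𝓐 i A ≡ true ⇔ (∣ A ∣ ≡ r i × T ⊆ A))))))
theorem2 m t n r _ 1≤r t≤r r-mono n₀≤n 𝓐 𝓐-unif cross =
  subst (_≤ prod k starSize) (sym card≡count′) prod-bound ,
  mk⇔ (λ prod≡ → Extremal.common-star (trans (sym card≡count′) prod≡))
      (λ star → trans card≡count′ (star⇒prod≡ star))
  where
  open CrossIntersectingFamilies m t n r 1≤r t≤r r-mono n₀≤n 𝓐 𝓐-unif cross
  card≡count′ : prod k (λ i → card (𝓐 i)) ≡ prod k ∣𝓐∣
  card≡count′ = prod-cong k (λ i → card≡count (𝓐 i))
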